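{- Let $\pi\in\mathfrak{B}_n$ be a signed involution, let $1\le i,j\le n+1$ with $i\ne j$, and let $p,q\in\{0,1\}$. If $d^+(i,j)=(p,q)$ then $\operatorname{des}^B(\xi_{(i,j)}(\pi))=\operatorname{des}^B(\pi)+p+q$, and if $d^-(i,j)=(p,q)$ then $\operatorname{des}^B(\overline{\xi}_{(i,j)}(\pi))=\operatorname{des}^B(\pi)+p+q$.
   Context: $\mathfrak{B}_n$ is the set of signed permutations $\pi=\pi_1\cdots\pi_n$ ($\pi_i\in\{\pm1,\dots,\pm n\}$, $|\pi_1|,\dots,|\pi_n|$ a permutation of $[n]$), $\pi_0=0$; inverse given by $\pi^{ -1}_{|\pi_i|}=\operatorname{sgn}(\pi_i)\,i$; $\pi$ is a signed involution if $\pi^{ -1}=\pi$. Natural order: $\operatorname{des}^B(\pi)=|\{i\in\{0,\dots,n-1\}:\pi_i>\pi_{i+1}\}|$, $\operatorname{ides}^B(\pi)=\operatorname{des}^B(\pi^{ -1})$. For $\pi\in\mathfrak{B}_m$ and $i,j\in[m+1]$, $\varphi_{(i,j)}(\pi)$ is the $\sigma\in\mathfrak{B}_{m+1}$ with $\sigma_i=j$, $\sigma_k=s(\pi_k)$ for $k<i$, $\sigma_k=s(\pi_{k-1})$ for $k>i$, where $s(x)=x$ if $|x|<j$, $s(x)=x+1$ if $x\ge j$, $s(x)=x-1$ if $x\le-j$; $\overline{\varphi}_{(i,j)}(\pi)$ is the same with $\sigma_i=-j$. $d^+(i,j)=\big(\operatorname{des}^B(\varphi_{(i,j)}(\pi))-\operatorname{des}^B(\pi),\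 \operatorname{ides}^B(\varphi_{(i,j)}(\pi))-\operatorname{ides}^B(\pi)\big)$, $d^-(i,j)$ the same with $\overline{\varphi}_{(i,j)}$. For $i\ne j$ in $[n+1]$: $\xi_{(i,j)}=\varphi_{(j+1,i)}\circ\varphi_{(i,j)}$ if $i<j$ and $\xi_{(i,j)}=\varphi_{(j,i+1)}\circ\varphi_{(i,j)}$ if $i>j$; $\overline{\xi}_{(i,j)}$ is defined the same way with $\overline{\varphi}$ in place of $\varphi$ (these insert two squares symmetric about the main diagonal, producing a signed involution in $\mathfrak{B}_{n+2}$). -}

module Defs where

open import Data.Nat as ℕ using (ℕ; zero; suc)
import Data.Nat.Properties as ℕP
open import Data.Integer as ℤ using (ℤ; +_; -[1+_]; ∣_∣; sign; _◃_)
open import Data.Integer.Properties using ()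
open import Data.List using (List; []; _∷_; _++_; [_]; map; take; drop; length; upTo)
open import Data.List.Relation.Binary.Permutation.Propositional using (_↭_)
open import Data.Bool using (Bool; true; false; if_then_else_)
open import Data.Product using (_×_; _,_)
open import Relation.Nullary.Decidable using (⌊_⌋)
open import Relation.Binary.PropositionalEquality using (_≡_)

-- A signed permutation π = π₁⋯πₙ is represented by the list [π₁,…,πₙ] of integers.

IsSignedPerm : ℕ → List ℤ → Set
IsSignedPerm n π = (length π ≡ n) × (map ∣_∣ π ↭ map suc (upTo n))

-- Inverse: π⁻¹_{|πᵢ|} = sgn(πᵢ)·i.
-- findInv k idx l : the signed position of the entry of absolute value k
-- (positions counted from idx); junk 0 if absent.
findInv : ℕ → ℕ → List ℤ → ℤ
findInv k idx [] = + 0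
findInv k idx (x ∷ l) = if ⌊ ∣ x ∣ ℕ.≟ k ⌋ then sign x ◃ idx else findInv k (suc idx) l

inverse : List ℤ → List ℤ
inverse π = map (λ k → findInv (suc k) 1 π) (upTo (length π))

IsSignedInvolution : ℕ → List ℤ → Set
IsSignedInvolution n π = IsSignedPerm n π × (inverse π ≡ π)

descents : List ℤ → ℕ
descents [] = 0
descents (x ∷ []) = 0
descents (x ∷ y ∷ l) = (if ⌊ y ℤ.<? x ⌋ then 1 else 0) ℕ.+ descents (y ∷ l)

desB : List ℤ → ℕ
desB π = descents (+ 0 ∷ π)

ides : List ℤ → ℕ
ides π = desB (inverse π)

shift : ℕ → ℤ → ℤ
shift j x =
  if ⌊ ∣ x ∣ ℕ.<? j ⌋ then x
  else (if ⌊ + j ℤ.≤? x ⌋ then x ℤ.+ + 1 else x ℤ.- + 1)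

insertAt : ℕ → ℤ → List ℤ → List ℤ
insertAt i v l = take (i ℕ.∸ 1) l ++ [ v ] ++ drop (i ℕ.∸ 1) l

φ : ℕ → ℕ → List ℤ → List ℤ
φ i j π = insertAt i (+ j) (map (shift j) π)

φbar : ℕ → ℕ → List ℤ → List ℤ
φbar i j π = insertAt i (ℤ.- (+ j)) (map (shift j) π)

dPlus : ℕ → ℕ → List ℤ → ℤ × ℤ
dPlus i j π = ((+ desB (φ i j π)) ℤ.- (+ desB π)) , ((+ ides (φ i j π)) ℤ.- (+ ides π))

dMinus : ℕ → ℕ → List ℤ → ℤ × ℤ
dMinus i j π = ((+ desB (φbar i j π)) ℤ.- (+ desB π)) , ((+ ides (φbar i j π)) ℤ.- (+ ides π))

ξ : ℕ → ℕ → List ℤ → List ℤ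
ξ i j π = if ⌊ i ℕ.<? j ⌋ then φ (suc j) i (φ i j π) else φ j (suc i) (φ i j π)

ξbar : ℕ → ℕ → List ℤ → List ℤ
ξbar i j π = if ⌊ i ℕ.<? j ⌋ then φbar (suc j) i (φbar i j π) else φbar j (suc i) (φbar i j π)

-- φ_{(i,j)} inserts one entry and renumbers the others by an order-preserving map, so it changes
-- des^B only at the slot of the new entry.  In ξ_{(i,j)} the second entry is inserted into a slot
-- whose neighbours and value are an order-isomorphic image of those of the entry inserted by φ_{(j,i)};
-- hence des^B ξ_{(i,j)}(π) + des^B π = des^B φ_{(i,j)}(π) + des^B φ_{(j,i)}(π) for every π.
-- For a signed involution φ_{(i,j)}(π)⁻¹ = φ_{(j,i)}(π), so the last term is ides^B φ_{(i,j)}(π).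
module Submission where

open import Defs
open import Data.Bool.Base using (if_then_else_)
open import Data.Integer as ℤ using (ℤ; +_; -[1+_]; ∣_∣; sign; _◃_; +<+; -<+; -<-; +≤+)
import Data.Integer.Properties as ℤP
import Data.Integer.Tactic.RingSolver as ℤ-Solver
open import Data.List.Base using (List; []; _∷_; _++_; map; take; drop; length; upTo; applyUpTo)
import Data.List.Properties as List
open import Data.Nat as ℕ using (ℕ; zero; suc; _+_; _≤_; _<_; z≤n; s≤s; z<s)
import Data.Nat.Properties as ℕP
open import Algebra.Properties.CommutativeSemigroup ℕP.+-commutativeSemigroup using (interchange)
open import Data.Nat.Tactic.RingSolver using (solve-∀)
open import Data.Product.Base using (_×_; _,_; proj₁; proj₂)
open import Data.Sum.Base using (inj₁; inj₂)
open import Data.Sign.Base as Sign using (Sign)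
open import Function.Base using (_∘_)
open import Relation.Binary.Core using (_Preserves_⟶_)
open import Relation.Binary.Definitions using (tri<; tri≈; tri>)
open import Relation.Binary.PropositionalEquality
open import Relation.Nullary.Decidable using (yes; no; ⌊_⌋)
open import Relation.Nullary.Negation using (contradiction)

open ≡-Reasoning

punchIn : ℕ → ℕ → ℕ
punchIn j n = if ⌊ n ℕ.<? j ⌋ then n else suc n

punchIn-< : ∀ {j n} → n < j → punchIn j n ≡ n
punchIn-< {j} {n} n<j with n ℕ.<? j
... | yes _   = refl
... | no n≮j = contradiction n<j n≮j

punchIn-≥ : ∀ {j n} → j ≤ n → punchIn j n ≡ suc n
punchIn-≥ {j} {n} j≤n with n ℕ.<? j
... | yes n<j = contradiction j≤n (ℕP.<⇒≱ n<j)
... | no _    = refl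

punchIn-mono-< : ∀ j {m n} → m < n → punchIn j m < punchIn j n
punchIn-mono-< j {m} {n} m<n with m ℕ.<? j | n ℕ.<? j
... | yes _    | yes _   = m<n
... | yes _    | no _    = ℕP.m<n⇒m<1+n m<n
... | no m≮j | yes n<j = contradiction (ℕP.<-trans m<n n<j) m≮j
... | no _     | no _    = s≤s m<n

punchIn-injective : ∀ j {m n} → punchIn j m ≡ punchIn j n → m ≡ n
punchIn-injective j {m} {n} eq with ℕP.<-cmp m n
... | tri< m<n _ _ = contradiction eq (ℕP.<⇒≢ (punchIn-mono-< j m<n))
... | tri≈ _ m≡n _ = m≡n
... | tri> _ _ n<m = contradiction (sym eq) (ℕP.<⇒≢ (punchIn-mono-< j n<m))

punchIn-≟ : ∀ j m n → ⌊ punchIn j m ℕ.≟ punchIn j n ⌋ ≡ ⌊ m ℕ.≟ n ⌋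
punchIn-≟ j m n with punchIn j m ℕ.≟ punchIn j n | m ℕ.≟ n
... | yes _  | yes _  = refl
... | no _   | no _   = refl
... | yes eq | no m≢n = contradiction (punchIn-injective j eq) m≢n
... | no neq | yes m≡n = contradiction (cong (punchIn j) m≡n) neq

punchIn-≢ : ∀ j n → punchIn j n ≢ j
punchIn-≢ j n with n ℕ.<? j
... | yes n<j = ℕP.<⇒≢ n<j
... | no n≮j  = λ n+1≡j → n≮j (subst (n <_) n+1≡j (ℕP.n<1+n n))

punchIn-comm : ∀ {a b} n → a ≤ b → punchIn a (punchIn b n) ≡ punchIn (suc b) (punchIn a n)
punchIn-comm {a} {b} n a≤b with ℕP.<-≤-connex n a | ℕP.<-≤-connex n b
... | inj₁ n<a | _
  rewrite punchIn-< (ℕP.<-≤-trans n<a a≤b) | punchIn-< n<a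
        | punchIn-< {suc b} (ℕP.m<n⇒m<1+n (ℕP.<-≤-trans n<a a≤b)) = refl
... | inj₂ a≤n | inj₁ n<b
  rewrite punchIn-< n<b | punchIn-≥ a≤n | punchIn-< {suc b} (s≤s n<b) = refl
... | inj₂ a≤n | inj₂ b≤n
  rewrite punchIn-≥ b≤n | punchIn-≥ a≤n
        | punchIn-≥ {a} (ℕP.m≤n⇒m≤1+n a≤n) | punchIn-≥ {suc b} (s≤s b≤n) = refl

shift-◃ : ∀ j x → shift j x ≡ sign x ◃ punchIn j ∣ x ∣
shift-◃ j (+ n) with n ℕ.<? j
... | yes _ = sym (ℤP.+◃n≡+n n)
... | no n≮j with + j ℤ.≤? + n
...   | yes _   = cong +_ (ℕP.+-comm n 1)
...   | no j≰n = contradiction (+≤+ (ℕP.≮⇒≥ n≮j)) j≰n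
shift-◃ j -[1+ n ] with suc n ℕ.<? j
... | yes _ = refl
... | no _ with + j ℤ.≤? -[1+ n ]
...   | yes ()
...   | no _ = cong (λ k → -[1+ suc k ]) (ℕP.+-identityʳ n)

shift-+ : ∀ j n → shift j (+ n) ≡ + punchIn j n
shift-+ j n = trans (shift-◃ j (+ n)) (ℤP.+◃n≡+n _)

shift-- : ∀ j n → shift j -[1+ n ] ≡ ℤ.- + punchIn j (suc n)
shift-- j n = trans (shift-◃ j -[1+ n ]) (ℤP.-◃n≡-n _)

abs-shift : ∀ j x → ∣ shift j x ∣ ≡ punchIn j ∣ x ∣
abs-shift j x = trans (cong ∣_∣ (shift-◃ j x)) (ℤP.abs-◃ (sign x) _)

sign-shift : ∀ j x → sign (shift j x) ≡ sign x
sign-shift j (+ n) = cong sign (shift-+ j n)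
sign-shift j -[1+ n ] with suc n ℕ.<? j
... | yes _ = refl
... | no _ with + j ℤ.≤? -[1+ n ]
...   | yes ()
...   | no _ = refl

shift-mono-< : ∀ j → shift j Preserves ℤ._<_ ⟶ ℤ._<_
shift-mono-< j {+ m} {+ n} (+<+ m<n)
  rewrite shift-+ j m | shift-+ j n = +<+ (punchIn-mono-< j m<n)
shift-mono-< j { -[1+ m ]} {+ n} -<+
  rewrite shift-- j m | shift-+ j n =
    ℤP.<-≤-trans (ℤP.neg-mono-< (+<+ (ℕP.≤-<-trans z≤n (punchIn-mono-< j z<s)))) (+≤+ z≤n)
shift-mono-< j { -[1+ m ]} { -[1+ n ]} (-<- n<m)
  rewrite shift-- j m | shift-- j n = ℤP.neg-mono-< (+<+ (punchIn-mono-< j (s≤s n<m)))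

shift-small : ∀ {t} x → ∣ x ∣ < t → shift t x ≡ x
shift-small {t} x |x|<t =
  trans (shift-◃ t x) (trans (cong (sign x ◃_) (punchIn-< |x|<t)) (ℤP.◃-inverse x))

shift-◃-small : ∀ {t n} s → n < t → shift t (s ◃ n) ≡ s ◃ n
shift-◃-small {t} {n} s n<t = shift-small (s ◃ n) (subst (_< t) (sym (ℤP.abs-◃ s n)) n<t)

shift-zero : ∀ t → shift (suc t) (+ 0) ≡ + 0
shift-zero t = shift-small {suc t} (+ 0) (s≤s z≤n)

shift-◃-large : ∀ {t n} s → 1 ≤ t → t ≤ n → shift t (s ◃ n) ≡ s ◃ suc n
shift-◃-large {suc _} {zero} _ _ ()
shift-◃-large {t} {suc n} s _ t≤n = trans (shift-◃ t (s ◃ suc n))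
  (cong₂ _◃_ (ℤP.sign-◃ s (suc n)) (trans (cong (punchIn t) (ℤP.abs-◃ s (suc n))) (punchIn-≥ t≤n)))

shift-comm : ∀ {a b} x → a ≤ b → shift a (shift b x) ≡ shift (suc b) (shift a x)
shift-comm {a} {b} x a≤b = ℤP.◃-cong
  (trans (sign-shift a (shift b x)) (trans (sign-shift b x)
    (sym (trans (sign-shift (suc b) (shift a x)) (sign-shift a x)))))
  (begin
    ∣ shift a (shift b x) ∣              ≡⟨ abs-shift a (shift b x) ⟩
    punchIn a ∣ shift b x ∣              ≡⟨ cong (punchIn a) (abs-shift b x) ⟩
    punchIn a (punchIn b ∣ x ∣)          ≡⟨ punchIn-comm ∣ x ∣ a≤b ⟩
    punchIn (suc b) (punchIn a ∣ x ∣)    ≡⟨ cong (punchIn (suc b)) (abs-shift a x) ⟨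
    punchIn (suc b) ∣ shift a x ∣        ≡⟨ abs-shift (suc b) (shift a x) ⟨
    ∣ shift (suc b) (shift a x) ∣        ∎)

map-shift-comm : ∀ {a b} l → a ≤ b →
  map (shift a) (map (shift b) l) ≡ map (shift (suc b)) (map (shift a) l)
map-shift-comm l a≤b =
  trans (sym (List.map-∘ l)) (trans (List.map-cong (λ x → shift-comm x a≤b) l) (List.map-∘ l))

m+j≡n+k∧o+j≡p+k⇒m+p≡n+o : ∀ m n o p {j k} → m + j ≡ n + k → o + j ≡ p + k → m + p ≡ n + o
m+j≡n+k∧o+j≡p+k⇒m+p≡n+o m n o p {j} {k} m+j≡n+k o+j≡p+k =
  ℕP.+-cancelʳ-≡ (j + k) (m + p) (n + o) (begin
    (m + p) + (j + k)  ≡⟨ interchange m p j k ⟩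
    (m + j) + (p + k)  ≡⟨ cong₂ _+_ m+j≡n+k (sym o+j≡p+k) ⟩
    (n + k) + (o + j)  ≡⟨ interchange n k o j ⟩
    (n + o) + (k + j)  ≡⟨ cong (_+_ (n + o)) (ℕP.+-comm k j) ⟩
    (n + o) + (j + k)  ∎)

+m-+n≡+o⇒m≡n+o : ∀ {m n o} → + m ℤ.- + n ≡ + o → m ≡ n + o
+m-+n≡+o⇒m≡n+o {m} {n} {o} m-n≡o = ℤP.+-injective (begin
  + m                   ≡⟨ i≡[i-j]+j (+ m) (+ n) ⟩
  (+ m ℤ.- + n) ℤ.+ + n ≡⟨ cong (ℤ._+ + n) m-n≡o ⟩
  + o ℤ.+ + n           ≡⟨ ℤP.+-comm (+ o) (+ n) ⟩
  + (n + o)             ∎)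
  where
  i≡[i-j]+j : ∀ i j → i ≡ (i ℤ.- j) ℤ.+ j
  i≡[i-j]+j = ℤ-Solver.solve-∀

lastOr : ℤ → List ℤ → ℤ
lastOr x []      = x
lastOr _ (y ∷ l) = lastOr y l

lastOr-map : ∀ (f : ℤ → ℤ) x l → lastOr (f x) (map f l) ≡ f (lastOr x l)
lastOr-map f x []      = refl
lastOr-map f x (y ∷ l) = lastOr-map f y l

descentAt : ℤ → ℤ → ℕ
descentAt x y = if ⌊ y ℤ.<? x ⌋ then 1 else 0

descents-++ : ∀ x P Q → descents (x ∷ P ++ Q) ≡ descents (x ∷ P) + descents (lastOr x P ∷ Q)
descents-++ x []      Q = refl
descents-++ x (y ∷ P) Q =
  trans (cong (_+_ (descentAt x y)) (descents-++ y P Q))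
        (sym (ℕP.+-assoc (descentAt x y) (descents (y ∷ P)) (descents (lastOr y P ∷ Q))))

descentAt-strictMono : ∀ {f} → f Preserves ℤ._<_ ⟶ ℤ._<_ →
  ∀ x y → descentAt (f x) (f y) ≡ descentAt x y
descentAt-strictMono {f} mono x y with f y ℤ.<? f x | y ℤ.<? x
... | yes _      | yes _   = refl
... | no _       | no _    = refl
... | no fy≮fx | yes y<x = contradiction (mono y<x) fy≮fx
... | yes fy<fx | no y≮x with ℤP.<-cmp x y
...   | tri< x<y _ _ = contradiction (mono x<y) (ℤP.<-asym fy<fx)
...   | tri≈ _ refl _ = contradiction fy<fx (ℤP.<-irrefl refl)
...   | tri> _ _ y<x = contradiction y<x y≮x

descents-map : ∀ {f} → f Preserves ℤ._<_ ⟶ ℤ._<_ → ∀ l → descents (map f l) ≡ descents l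
descents-map mono []          = refl
descents-map mono (x ∷ [])    = refl
descents-map mono (x ∷ y ∷ l) =
  cong₂ _+_ (descentAt-strictMono mono x y) (descents-map mono (y ∷ l))

desB-map-shift : ∀ t l → desB (map (shift (suc t)) l) ≡ desB l
desB-map-shift t l =
  trans (cong (λ z → descents (z ∷ map (shift (suc t)) l)) (sym (shift-zero t)))
        (descents-map (shift-mono-< (suc t)) (+ 0 ∷ l))

-- The neighbours, in x ∷ L, of the entry that insertAt (suc k) adds to L; there is no right
-- neighbour when k ≥ length L.
leftOfSlot : ℤ → ℕ → List ℤ → ℤ
leftOfSlot x k L = lastOr x (take k L)

rightOfSlot : ℕ → List ℤ → List ℤ
rightOfSlot k L = take 1 (drop k L)

descents-insertAt-head : ∀ a v Q →
  descents (a ∷ v ∷ Q) + descents (a ∷ take 1 Q) ≡ descents (a ∷ Q) + descents (a ∷ v ∷ take 1 Q)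
descents-insertAt-head a v []      = ℕP.+-identityʳ _
descents-insertAt-head a v (q ∷ Q) =
  rearrange (descentAt a v) (descentAt v q) (descentAt a q) (descents (q ∷ Q))
  where
  rearrange : ∀ av vq aq rest → (av + (vq + rest)) + (aq + 0) ≡ (aq + rest) + (av + (vq + 0))
  rearrange = solve-∀

descents-insertAt : ∀ x k v L →
  descents (x ∷ insertAt (suc k) v L) + descents (leftOfSlot x k L ∷ rightOfSlot k L)
    ≡ descents (x ∷ L) + descents (leftOfSlot x k L ∷ v ∷ rightOfSlot k L)
descents-insertAt x k v L = begin
    descents (x ∷ P ++ v ∷ Q) + descents (a ∷ take 1 Q)
  ≡⟨ cong (_+ descents (a ∷ take 1 Q)) (descents-++ x P (v ∷ Q)) ⟩
    descents (x ∷ P) + descents (a ∷ v ∷ Q) + descents (a ∷ take 1 Q)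
  ≡⟨ ℕP.+-assoc (descents (x ∷ P)) _ _ ⟩
    descents (x ∷ P) + (descents (a ∷ v ∷ Q) + descents (a ∷ take 1 Q))
  ≡⟨ cong (_+_ (descents (x ∷ P))) (descents-insertAt-head a v Q) ⟩
    descents (x ∷ P) + (descents (a ∷ Q) + descents (a ∷ v ∷ take 1 Q))
  ≡⟨ ℕP.+-assoc (descents (x ∷ P)) _ _ ⟨
    descents (x ∷ P) + descents (a ∷ Q) + descents (a ∷ v ∷ take 1 Q)
  ≡⟨ cong (_+ descents (a ∷ v ∷ take 1 Q)) (descents-++ x P Q) ⟨
    descents (x ∷ P ++ Q) + descents (a ∷ v ∷ take 1 Q)
  ≡⟨ cong (λ l → descents (x ∷ l) + descents (a ∷ v ∷ take 1 Q)) (List.take++drop≡id k L) ⟩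
    descents (x ∷ L) + descents (a ∷ v ∷ take 1 Q)
  ∎
  where
  P = take k L
  Q = drop k L
  a = lastOr x P

desB-insertAt-matchingSlots : ∀ {f} → f Preserves ℤ._<_ ⟶ ℤ._<_ → ∀ k L v k′ L′ v′ →
  leftOfSlot (+ 0) k L ≡ f (leftOfSlot (+ 0) k′ L′) →
  rightOfSlot k L ≡ map f (rightOfSlot k′ L′) →
  v ≡ f v′ →
  desB (insertAt (suc k) v L) + desB L′ ≡ desB L + desB (insertAt (suc k′) v′ L′)
desB-insertAt-matchingSlots {f} mono k L v k′ L′ v′ left right value =
  m+j≡n+k∧o+j≡p+k⇒m+p≡n+o _ (desB L) (desB (insertAt (suc k′) v′ L′)) (desB L′)
    insertionInL insertionInL′
  where
  a′ = leftOfSlot (+ 0) k′ L′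
  r′ = rightOfSlot k′ L′
  neighbours : ∀ {a l a′ l′} → a ≡ f a′ → l ≡ map f l′ → descents (a ∷ l) ≡ descents (a′ ∷ l′)
  neighbours {a′ = a′} {l′ = l′} a≡ l≡ =
    trans (cong₂ (λ x l → descents (x ∷ l)) a≡ l≡) (descents-map mono (a′ ∷ l′))
  insertionInL :
    desB (insertAt (suc k) v L) + descents (a′ ∷ r′) ≡ desB L + descents (a′ ∷ v′ ∷ r′)
  insertionInL = subst₂ (λ m n → desB (insertAt (suc k) v L) + m ≡ desB L + n)
    (neighbours left right) (neighbours left (cong₂ _∷_ value right))
    (descents-insertAt (+ 0) k v L)
  insertionInL′ :
    desB (insertAt (suc k′) v′ L′) + descents (a′ ∷ r′) ≡ desB L′ + descents (a′ ∷ v′ ∷ r′)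
  insertionInL′ = descents-insertAt (+ 0) k′ v′ L′

leftOfSlot-map : ∀ {f : ℤ → ℤ} {x} → f x ≡ x →
  ∀ k L → leftOfSlot x k (map f L) ≡ f (leftOfSlot x k L)
leftOfSlot-map {f} {x} fx≡x k L = begin
  lastOr x (take k (map f L))      ≡⟨ cong (lastOr x) (List.take-map k L) ⟩
  lastOr x (map f (take k L))      ≡⟨ cong (λ y → lastOr y (map f (take k L))) fx≡x ⟨
  lastOr (f x) (map f (take k L))  ≡⟨ lastOr-map f x (take k L) ⟩
  f (lastOr x (take k L))          ∎

rightOfSlot-map : ∀ (f : ℤ → ℤ) k L → rightOfSlot k (map f L) ≡ map f (rightOfSlot k L)
rightOfSlot-map f k L = trans (cong (take 1) (List.drop-map k L)) (List.take-map 1 (drop k L))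

leftOfSlot-insertAt-< : ∀ x v {i k} L → i < k → k ≤ length L →
  leftOfSlot x (suc k) (insertAt (suc i) v L) ≡ leftOfSlot x k L
leftOfSlot-insertAt-< x v {zero}  {suc k} (y ∷ L) _         _         = refl
leftOfSlot-insertAt-< x v {suc i} {suc k} (y ∷ L) (s≤s i<k) (s≤s k≤n) =
  leftOfSlot-insertAt-< y v L i<k k≤n

rightOfSlot-insertAt-≤ : ∀ v {i k} L → i ≤ k →
  rightOfSlot (suc k) (insertAt (suc i) v L) ≡ rightOfSlot k L
rightOfSlot-insertAt-≤ v {zero}  L       _         = refl
rightOfSlot-insertAt-≤ v {suc i} []      (s≤s i≤k) = refl
rightOfSlot-insertAt-≤ v {suc i} (y ∷ L) (s≤s i≤k) = rightOfSlot-insertAt-≤ v L i≤k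

leftOfSlot-insertAt-≥ : ∀ x v {i k} L → k ≤ i → k ≤ length L →
  leftOfSlot x k (insertAt (suc i) v L) ≡ leftOfSlot x k L
leftOfSlot-insertAt-≥ x v {i}     {zero}  L       _         _         = refl
leftOfSlot-insertAt-≥ x v {suc i} {suc k} (y ∷ L) (s≤s k≤i) (s≤s k≤n) =
  leftOfSlot-insertAt-≥ y v L k≤i k≤n

rightOfSlot-insertAt-> : ∀ v {i k} L → k < i → k < length L →
  rightOfSlot k (insertAt (suc i) v L) ≡ rightOfSlot k L
rightOfSlot-insertAt-> v {suc i} {zero}  (y ∷ L) _         _         = refl
rightOfSlot-insertAt-> v {suc i} {suc k} (y ∷ L) (s≤s k<i) (s≤s k<n) =
  rightOfSlot-insertAt-> v L k<i k<n

-- For i, j ≥ 1, φ, ξ and dPlus are definitionally the instances s = + of the following, and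
-- φbar, ξbar and dMinus the instances s = -.
φ[_] : Sign → ℕ → ℕ → List ℤ → List ℤ
φ[ s ] i j π = insertAt i (s ◃ j) (map (shift j) π)

ξ[_] : Sign → ℕ → ℕ → List ℤ → List ℤ
ξ[ s ] i j π =
  if ⌊ i ℕ.<? j ⌋ then φ[ s ] (suc j) i (φ[ s ] i j π) else φ[ s ] j (suc i) (φ[ s ] i j π)

d[_] : Sign → ℕ → ℕ → List ℤ → ℤ × ℤ
d[ s ] i j π = (+ desB (φ[ s ] i j π) ℤ.- + desB π) , (+ ides (φ[ s ] i j π) ℤ.- + ides π)

ξ-< : ∀ s {i j} π → i < j → ξ[ s ] i j π ≡ φ[ s ] (suc j) i (φ[ s ] i j π)
ξ-< s {i} {j} π i<j with i ℕ.<? j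
... | yes _   = refl
... | no i≮j = contradiction i<j i≮j

ξ-> : ∀ s {i j} π → j < i → ξ[ s ] i j π ≡ φ[ s ] j (suc i) (φ[ s ] i j π)
ξ-> s {i} {j} π j<i with i ℕ.<? j
... | yes i<j = contradiction i<j (ℕP.<-asym j<i)
... | no _    = refl

desB-ξ-< : ∀ s {i′ j′} π → i′ < j′ → j′ ≤ length π →
  desB (ξ[ s ] (suc i′) (suc j′) π) + desB π
    ≡ desB (φ[ s ] (suc i′) (suc j′) π) + desB (φ[ s ] (suc j′) (suc i′) π)
desB-ξ-< s {i′} {j′} π i′<j′ j′≤length = begin
    desB (ξ[ s ] i j π) + desB π
  ≡⟨ cong₂ _+_ (cong desB (ξ-< s π (s≤s i′<j′))) (sym (desB-map-shift i′ π)) ⟩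
    desB (insertAt (suc j) (s ◃ i) (map si σ)) + desB (map si π)
  ≡⟨ desB-insertAt-matchingSlots (shift-mono-< (suc j)) j (map si σ) (s ◃ i) j′ (map si π) (s ◃ i)
       left right (sym (shift-◃-small s (s≤s (s≤s (ℕP.<⇒≤ i′<j′))))) ⟩
    desB (map si σ) + desB τ
  ≡⟨ cong (_+ desB τ) (desB-map-shift i′ σ) ⟩
    desB σ + desB τ
  ∎
  where
  i = suc i′
  j = suc j′
  si = shift i
  sj = shift j
  σ = φ[ s ] i j π
  τ = φ[ s ] j i π
  j′≤n : j′ ≤ length (map sj π)
  j′≤n = subst (j′ ≤_) (sym (List.length-map sj π)) j′≤length
  left : leftOfSlot (+ 0) j (map si σ) ≡ shift (suc j) (leftOfSlot (+ 0) j′ (map si π))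
  left = begin
      leftOfSlot (+ 0) j (map si σ)
    ≡⟨ leftOfSlot-map (shift-zero i′) j σ ⟩
      si (leftOfSlot (+ 0) j σ)
    ≡⟨ cong si (leftOfSlot-insertAt-< (+ 0) (s ◃ j) (map sj π) i′<j′ j′≤n) ⟩
      si (leftOfSlot (+ 0) j′ (map sj π))
    ≡⟨ cong si (leftOfSlot-map (shift-zero j′) j′ π) ⟩
      si (sj (leftOfSlot (+ 0) j′ π))
    ≡⟨ shift-comm (leftOfSlot (+ 0) j′ π) (s≤s (ℕP.<⇒≤ i′<j′)) ⟩
      shift (suc j) (si (leftOfSlot (+ 0) j′ π))
    ≡⟨ cong (shift (suc j)) (leftOfSlot-map (shift-zero i′) j′ π) ⟨
      shift (suc j) (leftOfSlot (+ 0) j′ (map si π))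
    ∎
  right : rightOfSlot j (map si σ) ≡ map (shift (suc j)) (rightOfSlot j′ (map si π))
  right = begin
      rightOfSlot j (map si σ)
    ≡⟨ rightOfSlot-map si j σ ⟩
      map si (rightOfSlot j σ)
    ≡⟨ cong (map si) (rightOfSlot-insertAt-≤ (s ◃ j) (map sj π) (ℕP.<⇒≤ i′<j′)) ⟩
      map si (rightOfSlot j′ (map sj π))
    ≡⟨ cong (map si) (rightOfSlot-map sj j′ π) ⟩
      map si (map sj (rightOfSlot j′ π))
    ≡⟨ map-shift-comm (rightOfSlot j′ π) (s≤s (ℕP.<⇒≤ i′<j′)) ⟩
      map (shift (suc j)) (map si (rightOfSlot j′ π))
    ≡⟨ cong (map (shift (suc j))) (rightOfSlot-map si j′ π) ⟨
      map (shift (suc j)) (rightOfSlot j′ (map si π))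
    ∎

desB-ξ-> : ∀ s {i′ j′} π → j′ < i′ → i′ ≤ length π →
  desB (ξ[ s ] (suc i′) (suc j′) π) + desB π
    ≡ desB (φ[ s ] (suc i′) (suc j′) π) + desB (φ[ s ] (suc j′) (suc i′) π)
desB-ξ-> s {i′} {j′} π j′<i′ i′≤n = begin
    desB (ξ[ s ] i j π) + desB π
  ≡⟨ cong₂ _+_ (cong desB (ξ-> s π (s≤s j′<i′))) (sym (desB-map-shift i′ π)) ⟩
    desB (insertAt j (s ◃ suc i) (map S σ)) + desB (map si π)
  ≡⟨ desB-insertAt-matchingSlots (shift-mono-< j) j′ (map S σ) (s ◃ suc i) j′ (map si π) (s ◃ i)
       left right (sym (shift-◃-large s (s≤s z≤n) (s≤s (ℕP.<⇒≤ j′<i′)))) ⟩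
    desB (map S σ) + desB τ
  ≡⟨ cong (_+ desB τ) (desB-map-shift i σ) ⟩
    desB σ + desB τ
  ∎
  where
  i = suc i′
  j = suc j′
  si = shift i
  sj = shift j
  S = shift (suc i)
  σ = φ[ s ] i j π
  τ = φ[ s ] j i π
  j′<n : j′ < length (map sj π)
  j′<n = subst (j′ <_) (sym (List.length-map sj π)) (ℕP.<-≤-trans j′<i′ i′≤n)
  left : leftOfSlot (+ 0) j′ (map S σ) ≡ sj (leftOfSlot (+ 0) j′ (map si π))
  left = begin
      leftOfSlot (+ 0) j′ (map S σ)
    ≡⟨ leftOfSlot-map (shift-zero i) j′ σ ⟩
      S (leftOfSlot (+ 0) j′ σ)
    ≡⟨ cong S (leftOfSlot-insertAt-≥ (+ 0) (s ◃ j) (map sj π) (ℕP.<⇒≤ j′<i′) (ℕP.<⇒≤ j′<n)) ⟩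
      S (leftOfSlot (+ 0) j′ (map sj π))
    ≡⟨ cong S (leftOfSlot-map (shift-zero j′) j′ π) ⟩
      S (sj (leftOfSlot (+ 0) j′ π))
    ≡⟨ shift-comm (leftOfSlot (+ 0) j′ π) (s≤s (ℕP.<⇒≤ j′<i′)) ⟨
      sj (si (leftOfSlot (+ 0) j′ π))
    ≡⟨ cong sj (leftOfSlot-map (shift-zero i′) j′ π) ⟨
      sj (leftOfSlot (+ 0) j′ (map si π))
    ∎
  right : rightOfSlot j′ (map S σ) ≡ map sj (rightOfSlot j′ (map si π))
  right = begin
      rightOfSlot j′ (map S σ)
    ≡⟨ rightOfSlot-map S j′ σ ⟩
      map S (rightOfSlot j′ σ)
    ≡⟨ cong (map S) (rightOfSlot-insertAt-> (s ◃ j) (map sj π) j′<i′ j′<n) ⟩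
      map S (rightOfSlot j′ (map sj π))
    ≡⟨ cong (map S) (rightOfSlot-map sj j′ π) ⟩
      map S (map sj (rightOfSlot j′ π))
    ≡⟨ map-shift-comm (rightOfSlot j′ π) (s≤s (ℕP.<⇒≤ j′<i′)) ⟨
      map sj (map si (rightOfSlot j′ π))
    ≡⟨ cong (map sj) (rightOfSlot-map si j′ π) ⟨
      map sj (rightOfSlot j′ (map si π))
    ∎

desB-ξ : ∀ s {i j} π → i ≤ length π → j ≤ length π → i ≢ j →
  desB (ξ[ s ] (suc i) (suc j) π) + desB π
    ≡ desB (φ[ s ] (suc i) (suc j) π) + desB (φ[ s ] (suc j) (suc i) π)
desB-ξ s {i} {j} π i≤n j≤n i≢j with ℕP.<-cmp i j
... | tri< i<j _ _ = desB-ξ-< s π i<j j≤n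
... | tri≈ _ i≡j _ = contradiction i≡j i≢j
... | tri> _ _ j<i = desB-ξ-> s π j<i i≤n

length-insertAt : ∀ c v (l : List ℤ) → length (insertAt (suc c) v l) ≡ suc (length l)
length-insertAt zero    v l       = refl
length-insertAt (suc c) v []      = refl
length-insertAt (suc c) v (x ∷ l) = cong suc (length-insertAt c v l)

applyUpTo-cong : ∀ {A : Set} {f g : ℕ → A} → (∀ k → f k ≡ g k) → ∀ n → applyUpTo f n ≡ applyUpTo g n
applyUpTo-cong f≗g zero    = refl
applyUpTo-cong f≗g (suc n) = cong₂ _∷_ (f≗g 0) (applyUpTo-cong (f≗g ∘ suc) n)

applyUpTo-insert : ∀ {A : Set} (f g : ℕ → A) {c n} → c ≤ n →
  (∀ k → k < c → f k ≡ g k) → (∀ k → c ≤ k → f (suc k) ≡ g k) →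
  applyUpTo f (suc n) ≡ take c (applyUpTo g n) ++ f c ∷ drop c (applyUpTo g n)
applyUpTo-insert f g {zero}  _ _ above = cong (f 0 ∷_) (applyUpTo-cong (λ k → above k z≤n) _)
applyUpTo-insert f g {suc c} {suc n} (s≤s c≤n) below above =
  cong₂ _∷_ (below 0 (s≤s z≤n))
    (applyUpTo-insert (f ∘ suc) (g ∘ suc) c≤n
      (λ k k<c → below (suc k) (s≤s k<c)) (λ k c≤k → above (suc k) (s≤s c≤k)))

findInv-suc : ∀ {t} k idx l → 1 ≤ t → t ≤ idx → findInv k (suc idx) l ≡ shift t (findInv k idx l)
findInv-suc {suc t} k idx [] _ _ = sym (shift-zero t)
findInv-suc k idx (x ∷ l) 1≤t t≤idx with ∣ x ∣ ℕ.≟ k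
... | yes _ = sym (shift-◃-large (sign x) 1≤t t≤idx)
... | no _  = findInv-suc k (suc idx) l 1≤t (ℕP.m≤n⇒m≤1+n t≤idx)

findInv-insertAt : ∀ {m v} → ∣ v ∣ ≢ m → ∀ c l {idx} → 1 ≤ idx →
  findInv m idx (insertAt (suc c) v l) ≡ shift (idx + c) (findInv m idx l)
findInv-insertAt {m} {v} |v|≢m zero l {idx} 1≤idx with ∣ v ∣ ℕ.≟ m
... | yes |v|≡m = contradiction |v|≡m |v|≢m
... | no _ rewrite ℕP.+-identityʳ idx = findInv-suc m idx l 1≤idx ℕP.≤-refl
findInv-insertAt {m} {v} |v|≢m (suc c) [] {idx} 1≤idx with ∣ v ∣ ℕ.≟ m
... | yes |v|≡m = contradiction |v|≡m |v|≢m
... | no _ = sym (shift-small (+ 0) (ℕP.<-≤-trans 1≤idx (ℕP.m≤m+n idx (suc c))))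
findInv-insertAt {m} |v|≢m (suc c) (x ∷ l) {idx} 1≤idx with ∣ x ∣ ℕ.≟ m
... | yes _ = sym (shift-◃-small (sign x) (ℕP.m<m+n idx (s≤s z≤n)))
... | no _  = trans (findInv-insertAt |v|≢m c l (ℕP.m≤n⇒m≤1+n 1≤idx))
                    (cong (λ t → shift t (findInv m (suc idx) l)) (sym (ℕP.+-suc idx c)))

findInv-map-shift : ∀ j m idx l → findInv (punchIn j m) idx (map (shift j) l) ≡ findInv m idx l
findInv-map-shift j m idx []      = refl
findInv-map-shift j m idx (x ∷ l)
  rewrite abs-shift j x | punchIn-≟ j ∣ x ∣ m | sign-shift j x
        | findInv-map-shift j m (suc idx) l = refl

findInv-insertAt-shifted : ∀ {j v} → ∣ v ∣ ≡ j → ∀ c l idx → c ≤ length l →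
  findInv j idx (insertAt (suc c) v (map (shift j) l)) ≡ sign v ◃ (idx + c)
findInv-insertAt-shifted {j} {v} |v|≡j zero l idx _ with ∣ v ∣ ℕ.≟ j
... | yes _      = cong (sign v ◃_) (sym (ℕP.+-identityʳ idx))
... | no |v|≢j = contradiction |v|≡j |v|≢j
findInv-insertAt-shifted {j} {v} |v|≡j (suc c) (x ∷ l) idx (s≤s c≤n)
  rewrite abs-shift j x with punchIn j ∣ x ∣ ℕ.≟ j
... | yes eq = contradiction eq (punchIn-≢ j ∣ x ∣)
... | no _   = trans (findInv-insertAt-shifted |v|≡j c l (suc idx) c≤n)
                      (cong (sign v ◃_) (sym (ℕP.+-suc idx c)))

findInv-φ-old : ∀ s i j m π →
  findInv (punchIn j m) 1 (φ[ s ] (suc i) j π) ≡ shift (suc i) (findInv m 1 π)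
findInv-φ-old s i j m π =
  trans (findInv-insertAt |s◃j|≢punchIn i (map (shift j) π) (s≤s z≤n))
        (cong (shift (suc i)) (findInv-map-shift j m 1 π))
  where
  |s◃j|≢punchIn : ∣ s ◃ j ∣ ≢ punchIn j m
  |s◃j|≢punchIn eq = punchIn-≢ j m (trans (sym eq) (ℤP.abs-◃ s j))

findInv-φ-new : ∀ s {i} j π → i ≤ length π →
  findInv (suc j) 1 (φ[ s ] (suc i) (suc j) π) ≡ s ◃ suc i
findInv-φ-new s {i} j π i≤n =
  trans (findInv-insertAt-shifted (ℤP.abs-◃ s (suc j)) i π 1 i≤n)
        (cong (_◃ suc i) (ℤP.sign-◃ s (suc j)))

inverse-φ : ∀ s π {i j} → i ≤ length π → j ≤ length π →
  inverse (φ[ s ] (suc i) (suc j) π) ≡ φ[ s ] (suc j) (suc i) (inverse π)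
inverse-φ s π {i} {j} i≤n j≤n = begin
    inverse σ
  ≡⟨ cong (λ m → map F (upTo m)) length-σ ⟩
    map F (upTo (suc n))
  ≡⟨ List.map-upTo F (suc n) ⟩
    applyUpTo F (suc n)
  ≡⟨ applyUpTo-insert F (si ∘ G) j≤n below above ⟩
    take j (applyUpTo (si ∘ G) n) ++ F j ∷ drop j (applyUpTo (si ∘ G) n)
  ≡⟨ cong₂ (λ v l → take j l ++ v ∷ drop j l) (findInv-φ-new s j π i≤n) (sym inverseShifted) ⟩
    φ[ s ] (suc j) (suc i) (inverse π)
  ∎
  where
  n = length π
  si = shift (suc i)
  sj = shift (suc j)
  σ = φ[ s ] (suc i) (suc j) π
  F G : ℕ → ℤ
  F k = findInv (suc k) 1 σ
  G k = findInv (suc k) 1 π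
  length-σ : length σ ≡ suc n
  length-σ = trans (length-insertAt i (s ◃ suc j) (map sj π)) (cong suc (List.length-map sj π))
  below : ∀ k → k < j → F k ≡ si (G k)
  below k k<j = trans (cong (λ m → findInv m 1 σ) (sym (punchIn-< (s≤s k<j))))
                      (findInv-φ-old s i (suc j) (suc k) π)
  above : ∀ k → j ≤ k → F (suc k) ≡ si (G k)
  above k j≤k = trans (cong (λ m → findInv m 1 σ) (sym (punchIn-≥ (s≤s j≤k))))
                      (findInv-φ-old s i (suc j) (suc k) π)
  inverseShifted : map si (inverse π) ≡ applyUpTo (si ∘ G) n
  inverseShifted = trans (cong (map si) (List.map-upTo G n)) (List.map-applyUpTo G si n)

desB-ξ≡desB+p+q : ∀ s {n π} → IsSignedInvolution n π → ∀ {i j} → i ≤ n → j ≤ n → i ≢ j → ∀ {p q} →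
  d[ s ] (suc i) (suc j) π ≡ (+ p , + q) → desB (ξ[ s ] (suc i) (suc j) π) ≡ desB π + p + q
desB-ξ≡desB+p+q s {π = π} ((refl , _) , inverse-π≡π) {i} {j} i≤n j≤n i≢j {p} {q} d≡p,q =
  ℕP.+-cancelʳ-≡ (desB π) _ _ (begin
    desB (ξ[ s ] (suc i) (suc j) π) + desB π  ≡⟨ desB-ξ s π i≤n j≤n i≢j ⟩
    desB σ + desB τ                           ≡⟨ cong₂ _+_ desB-σ desB-τ ⟩
    (desB π + p) + (desB π + q)               ≡⟨ rearrange (desB π) p q ⟩
    desB π + p + q + desB π                   ∎)
  where
  σ = φ[ s ] (suc i) (suc j) π
  τ = φ[ s ] (suc j) (suc i) π
  desB-σ : desB σ ≡ desB π + p
  desB-σ = +m-+n≡+o⇒m≡n+o (cong proj₁ d≡p,q)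
  ides-σ : ides σ ≡ desB τ
  ides-σ = cong desB (trans (inverse-φ s π i≤n j≤n) (cong (φ[ s ] (suc j) (suc i)) inverse-π≡π))
  desB-τ : desB τ ≡ desB π + q
  desB-τ = subst₂ (λ a b → a ≡ b + q) ides-σ (cong desB inverse-π≡π)
                  (+m-+n≡+o⇒m≡n+o (cong proj₂ d≡p,q))
  rearrange : ∀ d p q → (d + p) + (d + q) ≡ d + p + q + d
  rearrange = solve-∀

proposition5p3 : (n : ℕ) (π : List ℤ) → IsSignedInvolution n π →
    (i j : ℕ) → 1 ≤ i → i ≤ suc n → 1 ≤ j → j ≤ suc n → i ≢ j →
    (p q : ℕ) → p ≤ 1 → q ≤ 1 →
    (dPlus i j π ≡ (+ p , + q) → desB (ξ i j π) ≡ desB π + p + q)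
    × (dMinus i j π ≡ (+ p , + q) → desB (ξbar i j π) ≡ desB π + p + q)
proposition5p3 n π inv (suc i) (suc j) _ (s≤s i≤n) _ (s≤s j≤n) i+1≢j+1 p q _ _ =
  desB-ξ≡desB+p+q Sign.+ inv i≤n j≤n i≢j , desB-ξ≡desB+p+q Sign.- inv i≤n j≤n i≢j
  where
  i≢j = i+1≢j+1 ∘ cong suc
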